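{- Let $\mathcal C$ be the symmetric monoidal closed category freely generated by a closed monoidal signature $\Sigma=(\Sigma_0,\Sigma_1)$. Then every morphism $f$ of $\mathcal C$ can be presented as a hierarchical foliation, i.e. \[ f=\Bigl(\bigotimes_{i}f_{1,i}\Bigr)\,;\,\cdots\,;\,\Bigl(\bigotimes_{i}f_{n,i}\Bigr), \] where each $f_{j,i}$ is either a generating morphism in $\Sigma_1$, a structural morphism, or $\Lambda_X(f')$ for some object $X$ and some morphism $f'$ which itself is presented as a hierarchical foliation.
   Context: Composition is written in diagrammatic order, $f;g:=g\circ f$. A closed monoidal signature is a pair $\Sigma=(\Sigma_0,\Sigma_1)$ where $\Sigma_0$ is a set of generating objects and $\Sigma_1$ a set of generating morphisms with sources and targets in $\mathrm{obj}_{\Sigma_0}$, the set of objects built inductively from a unit $I$ and elements of $\Sigma_0$ using $\otimes$ and $\multimap$. The freely generated symmetric monoidal closed category $\mathcal C$ has objects $\mathrm{obj}_{\Sigma_0}$ and morphisms the terms built from generators in $\Sigma_1$, identities, symmetries $\sigma_{A,B}$, evaluations $\mathrm{eval}_{X,A}:(X\multimap A)\otimes X\to A$, sequential composition, tensor, and abstraction (from $h:X\otimes A\to Y$ one forms $\Lambda_X(h):A\to X\multimap Y$), quotiented by the axioms of (non-strict) symmetric monoidal categories and the equations $(\Lambda_X(h)\otimes\mathrm{id}_X);\mathrm{eval}_{X,Y}=\sigma_{A,X};h$, $\Lambda_X(\sigma_{X,X\multimap Y};\mathrm{eval}_{X,Y})=\mathrm{id}_{X\multimap Y}$, and $f;\Lambda_X(g)=\Lambda_X((\mathrm{id}_X\otimes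 f);g)$. Structural morphisms are identities, symmetries, evaluation maps, and the associativity and unit isomorphisms of $\otimes$. -}

module Defs where

open import Data.Product using (Σ-syntax; _×_)

data Obj (Σ₀ : Set) : Set where
  I    : Obj Σ₀
  ⌜_⌝  : Σ₀ → Obj Σ₀
  _⊗_  : Obj Σ₀ → Obj Σ₀ → Obj Σ₀
  _⊸_  : Obj Σ₀ → Obj Σ₀ → Obj Σ₀

infixr 6 _⊗_
infixr 5 _⊸_

record Signature : Set₁ where
  field
    Σ₀  : Set
    Σ₁  : Set
    src : Σ₁ → Obj Σ₀
    tgt : Σ₁ → Obj Σ₀

module FreeSMCC (S : Signature) where
  open Signature S

  Ob : Set
  Ob = Obj Σ₀

  infixl 4 _⨾_
  infixr 6 _⊗₁_

  -- Morphism terms (composition in diagrammatic order: f ⨾ g = g ∘ f).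
  data Hom : Ob → Ob → Set where
    gen   : (g : Σ₁) → Hom (src g) (tgt g)
    id    : ∀ {A} → Hom A A
    σ     : ∀ {A B} → Hom (A ⊗ B) (B ⊗ A)
    eval  : ∀ {X A} → Hom ((X ⊸ A) ⊗ X) A
    α     : ∀ {A B C} → Hom ((A ⊗ B) ⊗ C) (A ⊗ (B ⊗ C))
    α⁻¹   : ∀ {A B C} → Hom (A ⊗ (B ⊗ C)) ((A ⊗ B) ⊗ C)
    λ↓    : ∀ {A} → Hom (I ⊗ A) A
    λ↑    : ∀ {A} → Hom A (I ⊗ A)
    ρ↓    : ∀ {A} → Hom (A ⊗ I) A
    ρ↑    : ∀ {A} → Hom A (A ⊗ I)
    _⨾_   : ∀ {A B C} → Hom A B → Hom B C → Hom A C
    _⊗₁_  : ∀ {A B C D} → Hom A B → Hom C D → Hom (A ⊗ C) (B ⊗ D)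
    Λ     : ∀ {A Y} (X : Ob) → Hom (X ⊗ A) Y → Hom A (X ⊸ Y)

  infix 3 _≈_

  data _≈_ : ∀ {A B} → Hom A B → Hom A B → Set where
    refl≈  : ∀ {A B} {f : Hom A B} → f ≈ f
    sym≈   : ∀ {A B} {f g : Hom A B} → f ≈ g → g ≈ f
    trans≈ : ∀ {A B} {f g h : Hom A B} → f ≈ g → g ≈ h → f ≈ h
    ⨾-cong : ∀ {A B C} {f f' : Hom A B} {g g' : Hom B C} → f ≈ f' → g ≈ g' → f ⨾ g ≈ f' ⨾ g'
    ⊗-cong : ∀ {A B C D} {f f' : Hom A B} {g g' : Hom C D} → f ≈ f' → g ≈ g' → f ⊗₁ g ≈ f' ⊗₁ g'
    Λ-cong : ∀ {A X Y} {h h' : Hom (X ⊗ A) Y} → h ≈ h' → Λ X h ≈ Λ X h'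
    idˡ    : ∀ {A B} {f : Hom A B} → id ⨾ f ≈ f
    idʳ    : ∀ {A B} {f : Hom A B} → f ⨾ id ≈ f
    assoc  : ∀ {A B C D} {f : Hom A B} {g : Hom B C} {h : Hom C D} → (f ⨾ g) ⨾ h ≈ f ⨾ (g ⨾ h)
    ⊗-id   : ∀ {A B} → id {A} ⊗₁ id {B} ≈ id
    ⊗-⨾    : ∀ {A B C D E F} {f : Hom A B} {g : Hom B C} {h : Hom D E} {k : Hom E F}
             → (f ⨾ g) ⊗₁ (h ⨾ k) ≈ (f ⊗₁ h) ⨾ (g ⊗₁ k)
    α-iso₁ : ∀ {A B C} → α {A} {B} {C} ⨾ α⁻¹ ≈ id
    α-iso₂ : ∀ {A B C} → α⁻¹ {A} {B} {C} ⨾ α ≈ id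
    λ-iso₁ : ∀ {A} → λ↓ {A} ⨾ λ↑ ≈ id
    λ-iso₂ : ∀ {A} → λ↑ {A} ⨾ λ↓ ≈ id
    ρ-iso₁ : ∀ {A} → ρ↓ {A} ⨾ ρ↑ ≈ id
    ρ-iso₂ : ∀ {A} → ρ↑ {A} ⨾ ρ↓ ≈ id
    σ-inv  : ∀ {A B} → σ {A} {B} ⨾ σ ≈ id
    α-nat  : ∀ {A A' B B' C C'} {f : Hom A A'} {g : Hom B B'} {h : Hom C C'}
             → ((f ⊗₁ g) ⊗₁ h) ⨾ α ≈ α ⨾ (f ⊗₁ (g ⊗₁ h))
    λ-nat  : ∀ {A B} {f : Hom A B} → (id {I} ⊗₁ f) ⨾ λ↓ ≈ λ↓ ⨾ f
    ρ-nat  : ∀ {A B} {f : Hom A B} → (f ⊗₁ id {I}) ⨾ ρ↓ ≈ ρ↓ ⨾ f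
    σ-nat  : ∀ {A A' B B'} {f : Hom A A'} {g : Hom B B'} → (f ⊗₁ g) ⨾ σ ≈ σ ⨾ (g ⊗₁ f)
    pentagon : ∀ {A B C D} → (α {A} {B} {C} ⊗₁ id {D}) ⨾ α ⨾ (id ⊗₁ α) ≈ α ⨾ α
    triangle : ∀ {A B} → α {A} {I} {B} ⨾ (id ⊗₁ λ↓) ≈ ρ↓ ⊗₁ id
    hexagon  : ∀ {A B C} → α {A} {B} {C} ⨾ σ ⨾ α ≈ (σ ⊗₁ id) ⨾ α ⨾ (id ⊗₁ σ)
    β      : ∀ {A X Y} {h : Hom (X ⊗ A) Y} → (Λ X h ⊗₁ id {X}) ⨾ eval ≈ σ ⨾ h
    η      : ∀ {X Y} → Λ X (σ {X} {X ⊸ Y} ⨾ eval) ≈ id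
    Λ-nat  : ∀ {A B X Y} {f : Hom A B} {g : Hom (X ⊗ B) Y} → f ⨾ Λ X g ≈ Λ X ((id {X} ⊗₁ f) ⨾ g)

  data Structural : ∀ {A B} → Hom A B → Set where
    s-id   : ∀ {A} → Structural (id {A})
    s-σ    : ∀ {A B} → Structural (σ {A} {B})
    s-eval : ∀ {X A} → Structural (eval {X} {A})
    s-α    : ∀ {A B C} → Structural (α {A} {B} {C})
    s-α⁻¹  : ∀ {A B C} → Structural (α⁻¹ {A} {B} {C})
    s-λ↓   : ∀ {A} → Structural (λ↓ {A})
    s-λ↑   : ∀ {A} → Structural (λ↑ {A})
    s-ρ↓   : ∀ {A} → Structural (ρ↓ {A})
    s-ρ↑   : ∀ {A} → Structural (ρ↑ {A})

  -- Hierarchical foliations (as a predicate on terms):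
  --   Atom:      a generator, a structural morphism, or Λ_X(f') with f' a foliation;
  --   Layer:     a tensor product (any bracketing) of atoms;
  --   Foliation: a sequential composite  L₁ ⨾ ⋯ ⨾ Lₙ  (n ≥ 1) of layers.
  data Atom      : ∀ {A B} → Hom A B → Set
  data Layer     : ∀ {A B} → Hom A B → Set
  data Foliation : ∀ {A B} → Hom A B → Set

  data Atom where
    a-gen    : (g : Σ₁) → Atom (gen g)
    a-struct : ∀ {A B} {f : Hom A B} → Structural f → Atom f
    a-Λ      : ∀ {A Y} (X : Ob) {f' : Hom (X ⊗ A) Y} → Foliation f' → Atom (Λ X f')

  data Layer where
    l-atom : ∀ {A B} {f : Hom A B} → Atom f → Layer f
    l-⊗    : ∀ {A B C D} {f : Hom A B} {g : Hom C D} → Layer f → Layer g → Layer (f ⊗₁ g)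

  data Foliation where
    f-layer : ∀ {A B} {f : Hom A B} → Layer f → Foliation f
    f-⨾     : ∀ {A B C} {f : Hom A B} {g : Hom B C} → Foliation f → Layer g → Foliation (f ⨾ g)

{-# OPTIONS --safe #-}
-- Generators, structural maps and abstractions of
-- foliations are one-atom foliations, and composites of foliations concatenate.
-- For a tensor f ⊗ g the interchange law gives f ⊗ g ≈ (f ⊗ id) ⨾ (id ⊗ g), and
-- whiskering a foliation L₁ ⨾ ⋯ ⨾ Lₙ with id is again a foliation, layer by
-- layer: (L₁ ⊗ id) ⨾ ⋯ ⨾ (Lₙ ⊗ id).
module Submission where

open import Defs
open import Data.Product using (Σ-syntax; _×_; _,_)

module Foliate (S : Signature) where
  open FreeSMCC S

  HasFoliation : ∀ {A B} → Hom A B → Set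
  HasFoliation {A} {B} f = Σ[ g ∈ Hom A B ] (Foliation g × g ≈ f)

  HasFoliation-resp-≈ : ∀ {A B} {f f' : Hom A B} → f ≈ f' → HasFoliation f → HasFoliation f'
  HasFoliation-resp-≈ f≈f' (g , G , g≈f) = g , G , trans≈ g≈f f≈f'

  foliation⇒HasFoliation : ∀ {A B} {f : Hom A B} → Foliation f → HasFoliation f
  foliation⇒HasFoliation {f = f} F = f , F , refl≈

  atom⇒HasFoliation : ∀ {A B} {f : Hom A B} → Atom f → HasFoliation f
  atom⇒HasFoliation a = foliation⇒HasFoliation (f-layer (l-atom a))

  id-layer : ∀ {A} → Layer (id {A})
  id-layer = l-atom (a-struct s-id)

  HasFoliation-⨾-layer : ∀ {A B C} {f : Hom A B} {g : Hom B C} →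
                         HasFoliation f → Layer g → HasFoliation (f ⨾ g)
  HasFoliation-⨾-layer {g = g} (k , K , k≈f) L = (k ⨾ g) , f-⨾ K L , ⨾-cong k≈f refl≈

  foliation-⨾ : ∀ {A B C} {f : Hom A B} {g : Hom B C} →
                Foliation f → Foliation g → HasFoliation (f ⨾ g)
  foliation-⨾ F (f-layer L) = HasFoliation-⨾-layer (foliation⇒HasFoliation F) L
  foliation-⨾ F (f-⨾ G L) = HasFoliation-resp-≈ assoc (HasFoliation-⨾-layer (foliation-⨾ F G) L)

  ⨾-⊗-idʳ : ∀ {A B C D} {f : Hom A B} {g : Hom B C} →
            (f ⊗₁ id {D}) ⨾ (g ⊗₁ id) ≈ (f ⨾ g) ⊗₁ id
  ⨾-⊗-idʳ = trans≈ (sym≈ ⊗-⨾) (⊗-cong refl≈ idˡ)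

  ⨾-⊗-idˡ : ∀ {A B C D} {f : Hom A B} {g : Hom B C} →
            (id {D} ⊗₁ f) ⨾ (id ⊗₁ g) ≈ id ⊗₁ (f ⨾ g)
  ⨾-⊗-idˡ = trans≈ (sym≈ ⊗-⨾) (⊗-cong idˡ refl≈)

  ⊗-interchange : ∀ {A B C D} {f : Hom A B} {g : Hom C D} → (f ⊗₁ id) ⨾ (id ⊗₁ g) ≈ f ⊗₁ g
  ⊗-interchange = trans≈ (sym≈ ⊗-⨾) (⊗-cong idʳ idˡ)

  foliation-⊗-idʳ : ∀ {A B C} {f : Hom A B} → Foliation f → HasFoliation (f ⊗₁ id {C})
  foliation-⊗-idʳ (f-layer L) = foliation⇒HasFoliation (f-layer (l-⊗ L id-layer))
  foliation-⊗-idʳ (f-⨾ F L) =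
    HasFoliation-resp-≈ ⨾-⊗-idʳ (HasFoliation-⨾-layer (foliation-⊗-idʳ F) (l-⊗ L id-layer))

  foliation-⊗-idˡ : ∀ {A B C} {f : Hom A B} → Foliation f → HasFoliation (id {C} ⊗₁ f)
  foliation-⊗-idˡ (f-layer L) = foliation⇒HasFoliation (f-layer (l-⊗ id-layer L))
  foliation-⊗-idˡ (f-⨾ F L) =
    HasFoliation-resp-≈ ⨾-⊗-idˡ (HasFoliation-⨾-layer (foliation-⊗-idˡ F) (l-⊗ id-layer L))

  HasFoliation-⨾ : ∀ {A B C} {f : Hom A B} {g : Hom B C} →
                   HasFoliation f → HasFoliation g → HasFoliation (f ⨾ g)
  HasFoliation-⨾ (f' , F , f'≈f) (g' , G , g'≈g) =
    HasFoliation-resp-≈ (⨾-cong f'≈f g'≈g) (foliation-⨾ F G)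

  HasFoliation-⊗ : ∀ {A B C D} {f : Hom A B} {g : Hom C D} →
                   HasFoliation f → HasFoliation g → HasFoliation (f ⊗₁ g)
  HasFoliation-⊗ (f' , F , f'≈f) (g' , G , g'≈g) =
    HasFoliation-resp-≈ (trans≈ ⊗-interchange (⊗-cong f'≈f g'≈g))
      (HasFoliation-⨾ (foliation-⊗-idʳ F) (foliation-⊗-idˡ G))

  HasFoliation-Λ : ∀ {A X Y} {f : Hom (X ⊗ A) Y} → HasFoliation f → HasFoliation (Λ X f)
  HasFoliation-Λ {X = X} (f' , F , f'≈f) =
    HasFoliation-resp-≈ (Λ-cong f'≈f) (atom⇒HasFoliation (a-Λ X F))

  foliate : ∀ {A B} (f : Hom A B) → HasFoliation f
  foliate (gen g) = atom⇒HasFoliation (a-gen g)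
  foliate id      = atom⇒HasFoliation (a-struct s-id)
  foliate σ       = atom⇒HasFoliation (a-struct s-σ)
  foliate eval    = atom⇒HasFoliation (a-struct s-eval)
  foliate α       = atom⇒HasFoliation (a-struct s-α)
  foliate α⁻¹     = atom⇒HasFoliation (a-struct s-α⁻¹)
  foliate λ↓      = atom⇒HasFoliation (a-struct s-λ↓)
  foliate λ↑      = atom⇒HasFoliation (a-struct s-λ↑)
  foliate ρ↓      = atom⇒HasFoliation (a-struct s-ρ↓)
  foliate ρ↑      = atom⇒HasFoliation (a-struct s-ρ↑)
  foliate (f ⨾ g)  = HasFoliation-⨾ (foliate f) (foliate g)
  foliate (f ⊗₁ g) = HasFoliation-⊗ (foliate f) (foliate g)
  foliate (Λ X f)  = HasFoliation-Λ (foliate f)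

mainTheorem4 : (S : Signature) → let open FreeSMCC S in
    ∀ {A B} (f : Hom A B) → Σ[ g ∈ Hom A B ] (Foliation g × g ≈ f)
mainTheorem4 S = Foliate.foliate S
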